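{- Let $k\ge2$ and let $(\sigma_1,\dots,\sigma_k)$ be an allowable sequence of permutations in $\mathfrak{S}_n$. Then the directed graph $\mathbf{G}(\sigma_1,\dots,\sigma_k)$ has no directed cycle.
   Context: For $\sigma,\gamma\in\mathfrak{S}_n$, the pair $(\sigma,\gamma)$ is allowable if (a) for all $1\le i<j\le n$, $\sigma(i)>\sigma(j)$ implies $\gamma(i)>\gamma(j)$, and (b) for all $1\le i<j<k\le n$ with $\sigma(i)<\sigma(j)<\sigma(k)$, it is not the case that $\gamma(j)<\gamma(k)<\gamma(i)$. A sequence $(\sigma_1,\dots,\sigma_k)$ with $k\ge2$ is an allowable sequence if $(\sigma_j,\sigma_{j+1})$ is allowable for every $1\le j\le k-1$. The directed graph $\mathbf{G}(\sigma_1,\dots,\sigma_k)$ has vertex set $\{(i,j):1\le i\le n,\,1\le j\le k\}$ and edges: horizontal edges $(i,j)\to(i,j+1)$ for $1\le j\le k-1$; vertical edges $(p,j)\to(i,j)$ for $i\ne p$ with $\sigma_j(i)<\sigma_j(p)$; diagonal edges $(p,j)\to(i,j-1)$ for $2\le j\le k$ and $1\le i<p\le n$ with $\sigma_j(i)<\sigma_j(p)$. -}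

module Defs where

open import Data.Nat using (ℕ; suc; _≤_)
open import Data.Fin using (Fin; toℕ; _<_)
open import Data.Fin.Permutation using (Permutation′; _⟨$⟩ʳ_)
open import Data.Product using (_×_; _,_)
open import Relation.Binary.PropositionalEquality using (_≡_; _≢_)
open import Relation.Binary.Construct.Closure.Transitive using (TransClosure)
open import Relation.Nullary using (¬_)

-- permutations of [n] are bijections Fin n ↔ Fin n (positions/values 0-indexed)

Allowable : ∀ {n} → Permutation′ n → Permutation′ n → Set
Allowable {n} σ γ =
  (∀ (i j : Fin n) → i < j → (σ ⟨$⟩ʳ j) < (σ ⟨$⟩ʳ i) → (γ ⟨$⟩ʳ j) < (γ ⟨$⟩ʳ i))
  × (∀ (i j l : Fin n) → i < j → j < l →
       (σ ⟨$⟩ʳ i) < (σ ⟨$⟩ʳ j) → (σ ⟨$⟩ʳ j) < (σ ⟨$⟩ʳ l) →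
       ¬ (((γ ⟨$⟩ʳ j) < (γ ⟨$⟩ʳ l)) × ((γ ⟨$⟩ʳ l) < (γ ⟨$⟩ʳ i))))

-- a sequence σ_1..σ_k is given as σ : Fin k → Permutation′ n (σ_{j+1} = σ j)
AllowableSeq : ∀ {n k} → (Fin k → Permutation′ n) → Set
AllowableSeq {n} {k} σ =
  ∀ (j j′ : Fin k) → suc (toℕ j) ≡ toℕ j′ → Allowable (σ j) (σ j′)

-- vertices (i , j): i ∈ Fin n (row), j ∈ Fin k (column)
Vertex : ℕ → ℕ → Set
Vertex n k = Fin n × Fin k

data Edge {n k} (σ : Fin k → Permutation′ n) : Vertex n k → Vertex n k → Set where
  horizontal : ∀ i j j′ → suc (toℕ j) ≡ toℕ j′ → Edge σ (i , j) (i , j′)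
  vertical : ∀ i p j → i ≢ p → (σ j ⟨$⟩ʳ i) < (σ j ⟨$⟩ʳ p) → Edge σ (p , j) (i , j)
  diagonal : ∀ i p j j′ → suc (toℕ j′) ≡ toℕ j → i < p →
             (σ j ⟨$⟩ʳ i) < (σ j ⟨$⟩ʳ p) → Edge σ (p , j) (i , j′)

HasDirectedCycle : ∀ {n k} → (Fin k → Permutation′ n) → Set
HasDirectedCycle {n} {k} σ = Data.Product.Σ (Vertex n k) λ v → TransClosure (Edge σ) v v

-- Let m be the leftmost column visited by a directed cycle. The cycle can enter column m only
-- by a diagonal edge (p, m+1) → (i, m) and leave it only by a horizontal edge (x, m) → (x, m+1);
-- in between it moves along vertical edges, which decrease σ_m, so σ_m(x) ≤ σ_m(i). Allowability
-- of (σ_m, σ_{m+1}) turns this into σ_{m+1}(x) < σ_{m+1}(p), so the vertical edge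
-- (p, m+1) → (x, m+1) cuts the excursion short. A cycle cannot stay inside column m, since σ_m
-- decreases along it. So every cycle yields one strictly right of column m, and after k steps
-- one lying in no column at all.

module Submission where

open import Defs
open import Data.Nat as ℕ using (ℕ; zero; suc; _≤_; _<?_; z≤n)
import Data.Nat.Properties as ℕ
open import Data.Fin as Fin using (Fin; toℕ)
import Data.Fin.Properties as Fin
open import Data.Fin.Induction using (<-wellFounded)
open import Data.Fin.Permutation using (Permutation′; _⟨$⟩ʳ_)
open import Data.Product using (_×_; _,_; proj₁; proj₂; ∃-syntax)
open import Data.Empty using (⊥-elim)
open import Function.Base using (_∘_)
open import Function.Bundles using (Injection)
open import Function.Properties.Inverse using (↔⇒↣)
open import Induction.WellFounded using (Acc; acc)
open import Relation.Binary.Definitions using (tri<; tri≈; tri>)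
open import Relation.Binary.PropositionalEquality using (_≡_; _≢_; refl; sym; trans)
open import Relation.Binary.Construct.Closure.Transitive using (TransClosure; [_]; _∷_; _∷ʳ_)
open import Relation.Nullary using (¬_; yes; no)

⟨$⟩ʳ-injective : ∀ {n} (π : Permutation′ n) {x y : Fin n} →
                 π ⟨$⟩ʳ x ≡ π ⟨$⟩ʳ y → x ≡ y
⟨$⟩ʳ-injective π = Injection.injective (↔⇒↣ π)

⟨$⟩ʳ-≤∧≢⇒< : ∀ {n} (π : Permutation′ n) {x y : Fin n} →
             (π ⟨$⟩ʳ x) Fin.≤ (π ⟨$⟩ʳ y) → x ≢ y → (π ⟨$⟩ʳ x) Fin.< (π ⟨$⟩ʳ y)
⟨$⟩ʳ-≤∧≢⇒< π πx≤πy x≢y = Fin.≤∧≢⇒< πx≤πy (x≢y ∘ ⟨$⟩ʳ-injective π)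

module _ {n} {σ γ : Permutation′ n} (allowable : Allowable σ γ) where

  ascent-reflected : ∀ {i p} → i Fin.< p →
                     (γ ⟨$⟩ʳ i) Fin.< (γ ⟨$⟩ʳ p) → (σ ⟨$⟩ʳ i) Fin.< (σ ⟨$⟩ʳ p)
  ascent-reflected {i} {p} i<p γi<γp with Fin.<-cmp (σ ⟨$⟩ʳ i) (σ ⟨$⟩ʳ p)
  ... | tri< σi<σp _ _ = σi<σp
  ... | tri≈ _ σi≡σp _ = ⊥-elim (Fin.<-irrefl (⟨$⟩ʳ-injective σ σi≡σp) i<p)
  ... | tri> _ _ σp<σi = ⊥-elim (Fin.<-asym γi<γp (proj₁ allowable i p i<p σp<σi))

  -- The case y < i is where condition (b) is used, on the triple y < i < p.
  below-ascent-top : ∀ {i p} → i Fin.< p → (γ ⟨$⟩ʳ i) Fin.< (γ ⟨$⟩ʳ p) →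
                     ∀ y → (σ ⟨$⟩ʳ y) Fin.≤ (σ ⟨$⟩ʳ i) → (γ ⟨$⟩ʳ y) Fin.< (γ ⟨$⟩ʳ p)
  below-ascent-top {i} {p} i<p γi<γp y σy≤σi with Fin.<-cmp y i
  ... | tri≈ _ refl _ = γi<γp
  ... | tri> _ y≢i i<y =
    Fin.<-trans (proj₁ allowable i y i<y (⟨$⟩ʳ-≤∧≢⇒< σ σy≤σi y≢i)) γi<γp
  ... | tri< y<i y≢i _ with Fin.<-cmp (γ ⟨$⟩ʳ y) (γ ⟨$⟩ʳ p)
  ...   | tri< γy<γp _ _ = γy<γp
  ...   | tri≈ _ γy≡γp _ =
    ⊥-elim (Fin.<-irrefl (⟨$⟩ʳ-injective γ γy≡γp) (Fin.<-trans y<i i<p))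
  ...   | tri> _ _ γp<γy =
    ⊥-elim (proj₂ allowable y i p y<i i<p (⟨$⟩ʳ-≤∧≢⇒< σ σy≤σi y≢i) (ascent-reflected i<p γi<γp)
                              (γi<γp , γp<γy))

module _ {n k} (σ : Fin k → Permutation′ n) where

  column : Vertex n k → ℕ
  column (_ , j) = toℕ j

  EdgeAbove : ℕ → Vertex n k → Vertex n k → Set
  EdgeAbove m u v = m ≤ column u × Edge σ u v × m ≤ column v

  WalkAbove : ℕ → Vertex n k → Vertex n k → Set
  WalkAbove m = TransClosure (EdgeAbove m)

  walk-start-column : ∀ {m u v} → WalkAbove m u v → m ≤ column u
  walk-start-column [ (m≤u , _ , _) ]   = m≤u
  walk-start-column ((m≤u , _ , _) ∷ _) = m≤u

  walkAbove-zero : ∀ {u v} → TransClosure (Edge σ) u v → WalkAbove 0 u v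
  walkAbove-zero [ e ]      = [ (z≤n , e , z≤n) ]
  walkAbove-zero (e ∷ walk) = (z≤n , e , z≤n) ∷ walkAbove-zero walk

  edge-irreflexive : ∀ {u} → ¬ Edge σ u u
  edge-irreflexive (horizontal _ _ _ j+1≡j)     = ℕ.1+n≢n j+1≡j
  edge-irreflexive (vertical _ _ _ i≢i _)       = i≢i refl
  edge-irreflexive (diagonal _ _ _ _ j+1≡j _ _) = ℕ.1+n≢n j+1≡j

  downward : ∀ {i p j} → (σ j ⟨$⟩ʳ i) Fin.< (σ j ⟨$⟩ʳ p) → Edge σ (p , j) (i , j)
  downward {i} {p} {j} σi<σp = vertical i p j (λ { refl → Fin.<-irrefl refl σi<σp }) σi<σp

  rotate-off-column : ∀ {a j} → Acc Fin._<_ (σ j ⟨$⟩ʳ a) → WalkAbove (toℕ j) (a , j) (a , j) →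
                      ∃[ u ] (toℕ j ℕ.< column u × WalkAbove (toℕ j) u u)
  rotate-off-column _ [ (_ , e , _) ] = ⊥-elim (edge-irreflexive e)
  rotate-off-column _ (e@(_ , horizontal _ _ _ j+1≡j′ , _) ∷ walk) =
    _ , ℕ.≤-reflexive j+1≡j′ , walk ∷ʳ e
  rotate-off-column (acc smaller) (e@(_ , vertical _ _ _ _ σy<σa , _) ∷ walk) =
    rotate-off-column (smaller σy<σa) (walk ∷ʳ e)
  rotate-off-column _ ((_ , diagonal _ _ _ _ j′+1≡j _ _ , j≤j′) ∷ _) =
    ⊥-elim (ℕ.<⇒≱ (ℕ.≤-reflexive j′+1≡j) j≤j′)

  Covers : Fin n → Fin k → Fin k → Fin n → Set
  Covers p j j′ x =
    ∀ y → (σ j′ ⟨$⟩ʳ y) Fin.≤ (σ j′ ⟨$⟩ʳ x) → (σ j ⟨$⟩ʳ y) Fin.< (σ j ⟨$⟩ʳ p)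

  module _ (allowable : AllowableSeq σ) where

    mutual
      bypass-column : ∀ {m u v} → WalkAbove m u v → m ℕ.< column u → m ℕ.< column v →
                      WalkAbove (suc m) u v
      bypass-column [ (_ , e , _) ] m<u m<v = [ (m<u , e , m<v) ]
      bypass-column {m} (_∷_ {y = w} (_ , e , m≤w) walk) m<u m<v with m <? column w
      ... | yes m<w = (m<u , e , m<w) ∷ bypass-column walk m<w m<v
      ... | no m≮w  = bypass-excursion e m<u (ℕ.≤-antisym (ℕ.≮⇒≥ m≮w) m≤w) walk m<v

      bypass-excursion : ∀ {m u w v} → Edge σ u w → m ℕ.< column u → column w ≡ m →
                         WalkAbove m w v → m ℕ.< column v → WalkAbove (suc m) u v
      bypass-excursion (horizontal _ _ _ j+1≡j′) m<j refl _ _ =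
        ⊥-elim (ℕ.<-irrefl refl (ℕ.<-trans m<j (ℕ.≤-reflexive j+1≡j′)))
      bypass-excursion (vertical _ _ _ _ _) j<j refl _ _ = ⊥-elim (ℕ.<-irrefl refl j<j)
      bypass-excursion (diagonal _ _ j j′ j′+1≡j i<p σi<σp) _ refl walk j′<v =
        return-from-column j′+1≡j
          (below-ascent-top {σ = σ j′} {σ j} (allowable j′ j j′+1≡j) i<p σi<σp) walk j′<v

      return-from-column : ∀ {p j j′ x v} → suc (toℕ j′) ≡ toℕ j → Covers p j j′ x →
                           WalkAbove (toℕ j′) (x , j′) v → toℕ j′ ℕ.< column v →
                           WalkAbove (suc (toℕ j′)) (p , j) v
      return-from-column j′+1≡j covers [ (_ , horizontal x _ _ j′+1≡j₂ , _) ] j′<v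
        with Fin.toℕ-injective (trans (sym j′+1≡j₂) j′+1≡j)
      ... | refl = [ (ℕ.≤-reflexive j′+1≡j , downward (covers x Fin.≤-refl) , j′<v) ]
      return-from-column j′+1≡j covers ((_ , horizontal x _ _ j′+1≡j₂ , _) ∷ walk) j′<v
        with Fin.toℕ-injective (trans (sym j′+1≡j₂) j′+1≡j)
      ... | refl = (j′<j , downward (covers x Fin.≤-refl) , j′<j) ∷ bypass-column walk j′<j j′<v
        where j′<j = ℕ.≤-reflexive j′+1≡j
      return-from-column _ _ [ (_ , vertical _ _ _ _ _ , _) ] j′<j′ =
        ⊥-elim (ℕ.<-irrefl refl j′<j′)
      return-from-column j′+1≡j covers ((_ , vertical _ _ _ _ σy<σx , _) ∷ walk) j′<v =
        return-from-column j′+1≡j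
          (λ z σz≤σy → covers z (ℕ.≤-trans σz≤σy (ℕ.<⇒≤ σy<σx))) walk j′<v
      return-from-column _ _ [ (_ , diagonal _ _ _ _ j″+1≡j′ _ _ , j′≤j″) ] _ =
        ⊥-elim (ℕ.<⇒≱ (ℕ.≤-reflexive j″+1≡j′) j′≤j″)
      return-from-column _ _ ((_ , diagonal _ _ _ _ j″+1≡j′ _ _ , j′≤j″) ∷ _) _ =
        ⊥-elim (ℕ.<⇒≱ (ℕ.≤-reflexive j″+1≡j′) j′≤j″)

    lift-cycle : ∀ {m u} → WalkAbove m u u → ∃[ u′ ] WalkAbove (suc m) u′ u′
    lift-cycle {m} {u} cycle with m <? column u
    ... | yes m<u = u , bypass-column cycle m<u m<u
    ... | no m≮u with ℕ.≤-antisym (ℕ.≮⇒≥ m≮u) (walk-start-column cycle)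
    ...   | refl with rotate-off-column (<-wellFounded _) cycle
    ...     | u′ , m<u′ , cycle′ = u′ , bypass-column cycle′ m<u′ m<u′

    cycle-above : ∀ m → HasDirectedCycle σ → ∃[ u ] WalkAbove m u u
    cycle-above zero    (u , cycle) = u , walkAbove-zero cycle
    cycle-above (suc m) cycle       = lift-cycle (proj₂ (cycle-above m cycle))

theorem5p5 : (n k : ℕ) → 2 ≤ k → (σ : Fin k → Permutation′ n) →
    AllowableSeq σ → ¬ HasDirectedCycle σ
theorem5p5 n k _ σ allowable cycle with cycle-above σ allowable k cycle
... | (_ , j) , cycle-right-of-every-column =
  ℕ.<⇒≱ (Fin.toℕ<n j) (walk-start-column σ cycle-right-of-every-column)
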